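{- Let $A[1..n]$ be a nonempty array containing a permutation of $\{1,\dots,n\}$ and let $T=\big(\bigodot_{i=1}^{n}0^{A[i]}1^{i}\big)\cdot 0^{n+1}1^{n+1}\cdot\big(\bigodot_{i=1}^{n+1}0^{n+1}1^{i}\big)\in\{0,1\}^*$. Then for every $j\in[0..n]$ and $v\in[1..n]$, $\mathrm{count}_A(j,v)=\mathrm{ISA}_T[j']-(b+j+1)$, where $b=|\{t: T[t..|T|]\prec 0^v1\}|$, $\ell_1=n(n+1)$, $\ell_2=2(n+1)$, $\delta=j\big(n+1+\tfrac{j+1}{2}\big)+(n+2-v)$, and $j'=\ell_1+\ell_2+\delta$.
   Context: $c^k$ is $k$ copies of symbol $c$, $\bigodot$ is concatenation, $0\prec1$. Lexicographic order: a proper prefix is smaller, otherwise compare at first difference. $\mathrm{count}_A(j,v)=|\{i\in(0..j]: A[i]\ge v\}|$. $\mathrm{SA}_T$ lists the starting positions of suffixes of $T$ in increasing lexicographic order and $\mathrm{ISA}_T$ is its inverse permutation (the lexicographic rank of each suffix). -}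

module Defs where

open import Data.Bool using (Bool; true; false)
open import Data.Nat using (ℕ; zero; suc; _+_; _*_; _∸_; _≤_; _<_; _≤?_; _<?_)
open import Data.Fin using (Fin; toℕ)
open import Data.List using (List; []; _∷_; _++_; replicate; concat; map; length; filter; drop; upTo; allFin)
open import Relation.Nullary using (Dec; yes; no; ¬_)
open import Relation.Binary.PropositionalEquality using (_≡_; refl)

-- Binary alphabet: false = 0, true = 1, with 0 ≺ 1.
data _<ᵇ_ : Bool → Bool → Set where
  f<t : false <ᵇ true

data _≺_ : List Bool → List Bool → Set where
  []≺   : ∀ {y ys} → [] ≺ (y ∷ ys)
  here  : ∀ {x y xs ys} → x <ᵇ y → (x ∷ xs) ≺ (y ∷ ys)
  there : ∀ {x xs ys} → xs ≺ ys → (x ∷ xs) ≺ (x ∷ ys)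

_≺?_ : (xs ys : List Bool) → Dec (xs ≺ ys)
[] ≺? [] = no λ ()
[] ≺? (y ∷ ys) = yes []≺
(x ∷ xs) ≺? [] = no λ ()
(false ∷ xs) ≺? (true ∷ ys) = yes (here f<t)
(true ∷ xs) ≺? (false ∷ ys) = no λ { (here ()) }
(false ∷ xs) ≺? (false ∷ ys) with xs ≺? ys
... | yes p = yes (there p)
... | no np = no λ { (here ()) ; (there p) → np p }
(true ∷ xs) ≺? (true ∷ ys) with xs ≺? ys
... | yes p = yes (there p)
... | no np = no λ { (here ()) ; (there p) → np p }

rep : ℕ → Bool → List Bool
rep k c = replicate k c

-- Suffix T[t..|T|] for a 1-indexed position t (1 ≤ t ≤ |T|).
suffix : List Bool → ℕ → List Bool
suffix T t = drop (t ∸ 1) T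

countSmaller : List Bool → List Bool → ℕ
countSmaller T w = length (filter (λ t → drop t T ≺? w) (upTo (length T)))

-- ISA_T[p]: the (1-based) lexicographic rank of the suffix starting at
-- 1-indexed position p, i.e. 1 + number of suffixes of T smaller than it.
ISA : List Bool → ℕ → ℕ
ISA T p = suc (countSmaller T (suffix T p))

-- A[1..n] is represented as A : Fin n → ℕ with A[i] = A (i-1).
-- count_A(j,v) = |{ i ∈ (0..j] : A[i] ≥ v }|
countA : ∀ {n} → (Fin n → ℕ) → ℕ → ℕ → ℕ
countA {n} A j v =
  length (filter (λ i → v ≤? A i) (filter (λ i → suc (toℕ i) ≤? j) (allFin n)))

textT : ∀ n → (Fin n → ℕ) → List Bool
textT n A =
  concat (map (λ i → rep (A i) false ++ rep (suc (toℕ i)) true) (allFin n))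
  ++ (rep (suc n) false ++ rep (suc n) true)
  ++ concat (map (λ i → rep (suc n) false ++ rep i true) (Data.List.applyUpTo suc (suc n)))

{-# OPTIONS --safe #-}
-- Every suffix of T is compared with S = 0^v 1^(j+1) R, the suffix at position j', where R is the
-- rest of the third part.  Suffixes below 0^v 1 are the b suffixes of the statement; the remaining
-- suffixes below S are exactly the suffixes 0^v 1^s N cut out of a zero run of length ≥ v, and such
-- a suffix is below S iff s ≤ j (a tie s = j+1 is decided by comparing the rest N with R).  Runs of
-- the first part therefore contribute count_A(j, v), the middle block nothing, and the third part
-- the j blocks of height at most j.  The position j' is found by summing the block lengths, where
-- the first part has length n(n+1) because A is a permutation.
module Submission where

open import Defs
open import Data.Bool using (Bool; true; false; if_then_else_)
open import Data.Nat
  using (ℕ; zero; suc; _+_; _*_; _∸_; _≤_; _<_; _≤?_; _≟_; z≤n; s≤s; z<s; s<s; pred; _/_)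
open import Data.Nat.Properties
open import Data.Nat.DivMod using (m*n/n≡m)
open import Data.Nat.Tactic.RingSolver using (solve-∀)
open import Algebra.Properties.CommutativeMonoid.Sum +-0-commutativeMonoid
  using (sum; sum-syntax; sum-remove; ∑-distrib-+)
open import Data.Fin using (Fin; toℕ; fromℕ<; punchIn)
open import Data.Fin.Properties
  using (any?; injective⇒≤; toℕ-fromℕ<; toℕ-injective; toℕ<n; punchIn-injective; punchInᵢ≢i)
open import Data.List
  using (List; []; _∷_; _++_; [_]; map; filter; drop; length; concat; applyUpTo; upTo; allFin; tabulate)
open import Data.List.Properties using (++-assoc; ++-identityʳ; map-tabulate; map-applyUpTo; map-upTo)
open import Data.List.Relation.Unary.All using (All; []; _∷_)
open import Data.List.Relation.Unary.All.Properties using (map⁺; tabulate⁺)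
open import Data.Product using (_×_; _,_; ∃-syntax; proj₁; proj₂)
open import Data.Sum using ([_,_]′)
open import Function using (_∘_)
open import Function.Definitions using (Injective)
open import Relation.Nullary using (Dec; yes; no; ¬_; does; contradiction)
open import Relation.Nullary.Decidable using (_×-dec_; ¬?; dec-true; dec-false)
open import Relation.Unary using (Decidable)
open import Relation.Binary.Definitions using (tri<; tri≈; tri>)
open import Relation.Binary.PropositionalEquality
  using (_≡_; refl; sym; trans; cong; cong₂; subst; module ≡-Reasoning)
open ≡-Reasoning

𝟙 : {P : Set} → Dec P → ℕ
𝟙 d = if does d then 1 else 0

𝟙-yes : {P : Set} (d : Dec P) → P → 𝟙 d ≡ 1
𝟙-yes d p rewrite dec-true d p = refl

𝟙-no : {P : Set} (d : Dec P) → ¬ P → 𝟙 d ≡ 0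
𝟙-no d ¬p rewrite dec-false d ¬p = refl

𝟙-cong : {P Q : Set} (d : Dec P) (e : Dec Q) → (P → Q) → (Q → P) → 𝟙 d ≡ 𝟙 e
𝟙-cong (yes _) (yes _) _ _ = refl
𝟙-cong (yes p) (no ¬q) f _ = contradiction (f p) ¬q
𝟙-cong (no ¬p) (yes q) _ g = contradiction (g q) ¬p
𝟙-cong (no _) (no _) _ _ = refl

𝟙-× : {P Q : Set} (d : Dec P) (e : Dec Q) → 𝟙 (d ×-dec e) ≡ 𝟙 d * 𝟙 e
𝟙-× (yes _) e = sym (+-identityʳ (𝟙 e))
𝟙-× (no _) e = refl

𝟙-split : {P Q : Set} (d : Dec P) (e : Dec Q) → (Q → P) → 𝟙 d ≡ 𝟙 e + 𝟙 (d ×-dec ¬? e)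
𝟙-split (yes _) (yes _) _ = refl
𝟙-split (yes _) (no _) _ = refl
𝟙-split (no ¬p) (yes q) f = contradiction (f q) ¬p
𝟙-split (no _) (no _) _ = refl

𝟙-≤-suc : ∀ m n → 𝟙 (m ≤? suc n) ≡ 𝟙 (suc n ≟ m) + 𝟙 (m ≤? n)
𝟙-≤-suc m n with m ≤? n | suc n ≟ m
... | yes m≤n | yes refl = contradiction m≤n (n≮n n)
... | yes m≤n | no 1+n≢m =
  trans (𝟙-yes (m ≤? suc n) (m≤n⇒m≤1+n m≤n))
        (sym (cong₂ _+_ (𝟙-no (suc n ≟ m) 1+n≢m) (𝟙-yes (m ≤? n) m≤n)))
... | no m≰n | yes refl =
  trans (𝟙-yes (suc n ≤? suc n) ≤-refl)
        (sym (cong₂ _+_ (𝟙-yes (suc n ≟ suc n) refl) (𝟙-no (suc n ≤? n) m≰n)))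
... | no m≰n | no 1+n≢m =
  trans (𝟙-no (m ≤? suc n) ([ m≰n ∘ ≤-pred , 1+n≢m ∘ sym ]′ ∘ m≤n⇒m<n∨m≡n))
        (sym (cong₂ _+_ (𝟙-no (suc n ≟ m) 1+n≢m) (𝟙-no (m ≤? n) m≰n)))

count : {A : Set} {P : A → Set} → Decidable P → List A → ℕ
count P? [] = 0
count P? (x ∷ xs) = 𝟙 (P? x) + count P? xs

module _ {A : Set} {P : A → Set} (P? : Decidable P) where

  length-filter≡count : ∀ xs → length (filter P? xs) ≡ count P? xs
  length-filter≡count [] = refl
  length-filter≡count (x ∷ xs) with does (P? x)
  ... | true = cong suc (length-filter≡count xs)
  ... | false = length-filter≡count xs

  count-filter : {Q : A → Set} (Q? : Decidable Q) → ∀ xs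
                 → count Q? (filter P? xs) ≡ count (λ x → P? x ×-dec Q? x) xs
  count-filter Q? [] = refl
  count-filter Q? (x ∷ xs) with does (P? x)
  ... | true = cong (𝟙 (Q? x) +_) (count-filter Q? xs)
  ... | false = count-filter Q? xs

  count-++ : ∀ xs ys → count P? (xs ++ ys) ≡ count P? xs + count P? ys
  count-++ [] ys = refl
  count-++ (x ∷ xs) ys =
    trans (cong (𝟙 (P? x) +_) (count-++ xs ys)) (sym (+-assoc (𝟙 (P? x)) _ _))

  count-map : {B : Set} (f : B → A) → ∀ xs → count P? (map f xs) ≡ count (P? ∘ f) xs
  count-map f [] = refl
  count-map f (x ∷ xs) = cong (𝟙 (P? (f x)) +_) (count-map f xs)

  count-⊆ : {Q : A → Set} (Q? : Decidable Q) → (∀ {x} → Q x → P x) → ∀ xs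
            → count P? xs ≡ count Q? xs + count (λ x → P? x ×-dec ¬? (Q? x)) xs
  count-⊆ Q? Q⊆P [] = refl
  count-⊆ Q? Q⊆P (x ∷ xs) =
    trans (cong₂ _+_ (𝟙-split (P? x) (Q? x) Q⊆P) (count-⊆ Q? Q⊆P xs))
          (interchange (𝟙 (Q? x)) (𝟙 (P? x ×-dec ¬? (Q? x))) (count Q? xs) _)
    where
    interchange : ∀ a b c d → (a + b) + (c + d) ≡ (a + c) + (b + d)
    interchange = solve-∀

nonemptyTails : {A : Set} → List A → List (List A)
nonemptyTails [] = []
nonemptyTails (x ∷ xs) = (x ∷ xs) ∷ nonemptyTails xs

nonemptyTails-++ : {A : Set} (xs ys : List A)
                   → nonemptyTails (xs ++ ys) ≡ map (_++ ys) (nonemptyTails xs) ++ nonemptyTails ys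
nonemptyTails-++ [] ys = refl
nonemptyTails-++ (x ∷ xs) ys = cong ((x ∷ xs ++ ys) ∷_) (nonemptyTails-++ xs ys)

applyUpTo-drop : {A : Set} (xs : List A) → applyUpTo (λ t → drop t xs) (length xs) ≡ nonemptyTails xs
applyUpTo-drop [] = refl
applyUpTo-drop (x ∷ xs) = cong ((x ∷ xs) ∷_) (applyUpTo-drop xs)

countSmaller≡count : ∀ T w → countSmaller T w ≡ count (_≺? w) (nonemptyTails T)
countSmaller≡count T w = begin
  length (filter (λ t → drop t T ≺? w) (upTo (length T)))
    ≡⟨ length-filter≡count (λ t → drop t T ≺? w) (upTo (length T)) ⟩
  count (λ t → drop t T ≺? w) (upTo (length T))
    ≡⟨ sym (count-map (_≺? w) (λ t → drop t T) (upTo (length T))) ⟩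
  count (_≺? w) (map (λ t → drop t T) (upTo (length T)))
    ≡⟨ cong (count (_≺? w)) (trans (map-upTo _ (length T)) (applyUpTo-drop T)) ⟩
  count (_≺? w) (nonemptyTails T) ∎

-- The lexicographic order on binary strings

≮[] : ∀ {X} → ¬ X ≺ []
≮[] ()

≺-irrefl : ∀ {X} → ¬ X ≺ X
≺-irrefl (here ())
≺-irrefl (there p) = ≺-irrefl p

∷-≺-∷⁻ : ∀ {x X Y} → (x ∷ X) ≺ (x ∷ Y) → X ≺ Y
∷-≺-∷⁻ (here ())
∷-≺-∷⁻ (there p) = p

++-≺-++⁺ : ∀ P {X Y} → X ≺ Y → (P ++ X) ≺ (P ++ Y)
++-≺-++⁺ [] p = p
++-≺-++⁺ (x ∷ P) p = there (++-≺-++⁺ P p)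

++-≺-++⁻ : ∀ P {X Y} → (P ++ X) ≺ (P ++ Y) → X ≺ Y
++-≺-++⁻ [] p = p
++-≺-++⁻ (x ∷ P) p = ++-≺-++⁻ P (∷-≺-∷⁻ p)

≺-++ʳ : ∀ {X Y} Z → X ≺ Y → X ≺ (Y ++ Z)
≺-++ʳ Z []≺ = []≺
≺-++ʳ Z (here p) = here p
≺-++ʳ Z (there p) = there (≺-++ʳ Z p)

ZeroLed : List Bool → Set
ZeroLed N = ∃[ N′ ] N ≡ false ∷ N′

NoLeadingOne : List Bool → Set
NoLeadingOne R = ∀ {Z} → ¬ (true ∷ Z) ≺ R

zeros-noLeadingOne : ∀ {k Y} → 1 ≤ k → NoLeadingOne (rep k false ++ Y)
zeros-noLeadingOne {suc k} _ (here ())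

zeros-≺ : ∀ {k m Y Z} → k < m → (rep m false ++ Y) ≺ (rep k false ++ true ∷ Z)
zeros-≺ z<s = here f<t
zeros-≺ (s<s k<m@(s≤s _)) = there (zeros-≺ k<m)

zeros-≮ : ∀ {k m Y Z} → k < m → ¬ (rep k false ++ true ∷ Z) ≺ (rep m false ++ Y)
zeros-≮ z<s (here ())
zeros-≮ (s<s (s≤s _)) (here ())
zeros-≮ (s<s k<m@(s≤s _)) (there p) = zeros-≮ k<m p

ones-≺ : ∀ {k m N Y} → k < m → ZeroLed N → (rep k true ++ N) ≺ (rep m true ++ Y)
ones-≺ z<s (_ , refl) = here f<t
ones-≺ (s<s k<m@(s≤s _)) led = there (ones-≺ k<m led)

ones-≮ : ∀ {k m Y R} → k < m → NoLeadingOne R → ¬ (rep m true ++ Y) ≺ (rep k true ++ R)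
ones-≮ z<s R≺1 p = R≺1 p
ones-≮ (s<s (s≤s _)) R≺1 (here ())
ones-≮ (s<s k<m@(s≤s _)) R≺1 (there p) = ones-≮ k<m R≺1 p

ones-≺⇒< : ∀ {s j N R} → NoLeadingOne R → (s ≡ j → ¬ N ≺ R)
           → (rep s true ++ N) ≺ (rep j true ++ R) → s < j
ones-≺⇒< {s} {j} R≺1 tie p with <-cmp s j
... | tri< s<j _ _ = s<j
... | tri≈ _ refl _ = contradiction (++-≺-++⁻ (rep s true) p) (tie refl)
... | tri> _ _ j<s = contradiction p (ones-≮ j<s R≺1)

𝟙-ones-≺ : ∀ {s j N R} → NoLeadingOne R → (s < j → ZeroLed N) → (s ≡ j → ¬ N ≺ R)
           → 𝟙 ((rep s true ++ N) ≺? (rep j true ++ R)) ≡ 𝟙 (s <? j)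
𝟙-ones-≺ {s} {j} {N} {R} R≺1 below tie =
  𝟙-cong ((rep s true ++ N) ≺? (rep j true ++ R)) (s <? j)
         (ones-≺⇒< R≺1 tie) (λ s<j → ones-≺ s<j (below s<j))

-- Texts made of blocks 0^a 1^(s+1)

Block : Set
Block = ℕ × ℕ

block : Block → List Bool
block (a , s) = rep a false ++ rep (suc s) true

render : List Block → List Bool → List Bool
render [] Y = Y
render ((a , s) ∷ bs) Y = rep a false ++ rep (suc s) true ++ render bs Y

render-++ : ∀ xs ys Y → render (xs ++ ys) Y ≡ render xs (render ys Y)
render-++ [] ys Y = refl
render-++ ((a , s) ∷ xs) ys Y = cong (λ Z → rep a false ++ rep (suc s) true ++ Z) (render-++ xs ys Y)

concat-map-block : {B : Set} (g : B → Block) (xs : List B) (Y : List Bool)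
                   → concat (map (block ∘ g) xs) ++ Y ≡ render (map g xs) Y
concat-map-block g [] Y = refl
concat-map-block g (x ∷ xs) Y = begin
  (block (g x) ++ concat (map (block ∘ g) xs)) ++ Y  ≡⟨ ++-assoc (block (g x)) _ Y ⟩
  block (g x) ++ (concat (map (block ∘ g) xs) ++ Y)  ≡⟨ cong (block (g x) ++_) (concat-map-block g xs Y) ⟩
  block (g x) ++ render (map g xs) Y                 ≡⟨ ++-assoc (rep (proj₁ (g x)) false) _ _ ⟩
  render (map g (x ∷ xs)) Y                          ∎

module Band (v : ℕ) (U : List Bool) where

  InBand : List Bool → Set
  InBand X = X ≺ (rep v false ++ true ∷ U) × ¬ X ≺ (rep v false ++ [ true ])

  inBand? : Decidable InBand
  inBand? X = (X ≺? (rep v false ++ true ∷ U)) ×-dec ¬? (X ≺? (rep v false ++ [ true ]))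

  bandCount : List Bool → ℕ
  bandCount T = count inBand? (nonemptyTails T)

  countSmaller-band : ∀ T → countSmaller T (rep v false ++ true ∷ U)
                            ≡ countSmaller T (rep v false ++ [ true ]) + bandCount T
  countSmaller-band T = begin
    countSmaller T S                              ≡⟨ countSmaller≡count T S ⟩
    count (_≺? S) (nonemptyTails T)               ≡⟨ count-⊆ (_≺? S) (_≺? w) ≺w⇒≺S (nonemptyTails T) ⟩
    count (_≺? w) (nonemptyTails T) + bandCount T ≡⟨ cong (_+ bandCount T) (sym (countSmaller≡count T w)) ⟩
    countSmaller T w + bandCount T                ∎
    where
    S w : List Bool
    S = rep v false ++ true ∷ U
    w = rep v false ++ [ true ]
    ≺w⇒≺S : ∀ {X} → X ≺ w → X ≺ S
    ≺w⇒≺S {X} X≺w = subst (X ≺_) (++-assoc (rep v false) [ true ] U) (≺-++ʳ U X≺w)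

  bandCount-++ : ∀ X Y
                 → bandCount (X ++ Y) ≡ count (λ Z → inBand? (Z ++ Y)) (nonemptyTails X) + bandCount Y
  bandCount-++ X Y = begin
    count inBand? (nonemptyTails (X ++ Y))
      ≡⟨ cong (count inBand?) (nonemptyTails-++ X Y) ⟩
    count inBand? (map (_++ Y) (nonemptyTails X) ++ nonemptyTails Y)
      ≡⟨ count-++ inBand? (map (_++ Y) (nonemptyTails X)) (nonemptyTails Y) ⟩
    count inBand? (map (_++ Y) (nonemptyTails X)) + bandCount Y
      ≡⟨ cong (_+ bandCount Y) (count-map inBand? (_++ Y) (nonemptyTails X)) ⟩
    count (λ Z → inBand? (Z ++ Y)) (nonemptyTails X) + bandCount Y ∎

  inBand-run⁻ : ∀ {k Z} → InBand (rep k false ++ true ∷ Z) → k ≡ v × Z ≺ U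
  inBand-run⁻ {k} (below , not-below) with <-cmp k v
  ... | tri< k<v _ _ = contradiction below (zeros-≮ k<v)
  ... | tri≈ _ refl _ = refl , ∷-≺-∷⁻ (++-≺-++⁻ (rep k false) below)
  ... | tri> _ _ v<k = contradiction (zeros-≺ v<k) not-below

  inBand-run⁺ : ∀ {k Z} → k ≡ v × Z ≺ U → InBand (rep k false ++ true ∷ Z)
  inBand-run⁺ {k} (refl , Z≺U) =
    ++-≺-++⁺ (rep k false) (there Z≺U) , ≮[] ∘ ∷-≺-∷⁻ ∘ ++-≺-++⁻ (rep k false)

  𝟙-inBand-run : ∀ k Z → 𝟙 (inBand? (rep k false ++ true ∷ Z)) ≡ 𝟙 (k ≟ v) * 𝟙 (Z ≺? U)
  𝟙-inBand-run k Z =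
    trans (𝟙-cong (inBand? _) ((k ≟ v) ×-dec (Z ≺? U)) inBand-run⁻ inBand-run⁺)
          (𝟙-× (k ≟ v) (Z ≺? U))

  count-zeros : 1 ≤ v → ∀ a Z
                → count (λ X → inBand? (X ++ true ∷ Z)) (nonemptyTails (rep a false))
                  ≡ 𝟙 (v ≤? a) * 𝟙 (Z ≺? U)
  count-zeros 1≤v zero Z =
    cong (_* 𝟙 (Z ≺? U)) (sym (𝟙-no (v ≤? 0) (λ v≤0 → contradiction (≤-trans 1≤v v≤0) λ ())))
  count-zeros 1≤v (suc a) Z = begin
    𝟙 (inBand? (rep (suc a) false ++ true ∷ Z)) + count _ (nonemptyTails (rep a false))
      ≡⟨ cong₂ _+_ (𝟙-inBand-run (suc a) Z) (count-zeros 1≤v a Z) ⟩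
    𝟙 (suc a ≟ v) * 𝟙 (Z ≺? U) + 𝟙 (v ≤? a) * 𝟙 (Z ≺? U)
      ≡⟨ sym (*-distribʳ-+ (𝟙 (Z ≺? U)) (𝟙 (suc a ≟ v)) _) ⟩
    (𝟙 (suc a ≟ v) + 𝟙 (v ≤? a)) * 𝟙 (Z ≺? U)
      ≡⟨ cong (_* 𝟙 (Z ≺? U)) (sym (𝟙-≤-suc v a)) ⟩
    𝟙 (v ≤? suc a) * 𝟙 (Z ≺? U) ∎

  bandCount-ones : 1 ≤ v → ∀ k N → bandCount (rep k true ++ N) ≡ bandCount N
  bandCount-ones 1≤v k N = trans (bandCount-++ (rep k true) N) (cong (_+ bandCount N) (ones k))
    where
    ones : ∀ k → count (λ X → inBand? (X ++ N)) (nonemptyTails (rep k true)) ≡ 0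
    ones zero = refl
    ones (suc k) = cong₂ _+_ (𝟙-no (inBand? _) (zeros-noLeadingOne 1≤v ∘ proj₁)) (ones k)

  bandCount-block : 1 ≤ v → ∀ a s N → bandCount (rep a false ++ rep (suc s) true ++ N)
                    ≡ 𝟙 ((rep s true ++ N) ≺? U) * 𝟙 (v ≤? a) + bandCount N
  bandCount-block 1≤v a s N = begin
    bandCount (rep a false ++ rep (suc s) true ++ N)
      ≡⟨ bandCount-++ (rep a false) (rep (suc s) true ++ N) ⟩
    count _ (nonemptyTails (rep a false)) + bandCount (rep (suc s) true ++ N)
      ≡⟨ cong₂ _+_ (count-zeros 1≤v a (rep s true ++ N)) (bandCount-ones 1≤v (suc s) N) ⟩
    𝟙 (v ≤? a) * 𝟙 ((rep s true ++ N) ≺? U) + bandCount N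
      ≡⟨ cong (_+ bandCount N) (*-comm (𝟙 (v ≤? a)) _) ⟩
    𝟙 ((rep s true ++ N) ≺? U) * 𝟙 (v ≤? a) + bandCount N ∎

  runCount : List Block → List Bool → ℕ
  runCount [] Y = 0
  runCount ((a , s) ∷ bs) Y = 𝟙 ((rep s true ++ render bs Y) ≺? U) * 𝟙 (v ≤? a) + runCount bs Y

  bandCount-render : 1 ≤ v → ∀ bs Y → bandCount (render bs Y) ≡ runCount bs Y + bandCount Y
  bandCount-render 1≤v [] Y = refl
  bandCount-render 1≤v ((a , s) ∷ bs) Y = begin
    bandCount (rep a false ++ rep (suc s) true ++ render bs Y)
      ≡⟨ bandCount-block 1≤v a s (render bs Y) ⟩
    k + bandCount (render bs Y)           ≡⟨ cong (k +_) (bandCount-render 1≤v bs Y) ⟩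
    k + (runCount bs Y + bandCount Y)     ≡⟨ sym (+-assoc k _ _) ⟩
    k + runCount bs Y + bandCount Y       ∎
    where
    k : ℕ
    k = 𝟙 ((rep s true ++ render bs Y) ≺? U) * 𝟙 (v ≤? a)

-- Staircases of blocks 0^c 1^(s+1), 0^c 1^(s+2), …

stairs : ℕ → ℕ → ℕ → List Block
stairs c s zero = []
stairs c s (suc k) = (c , s) ∷ stairs c (suc s) k

stairs-++ : ∀ c s k l → stairs c s (k + l) ≡ stairs c s k ++ stairs c (s + k) l
stairs-++ c s zero l = cong (λ t → stairs c t l) (sym (+-identityʳ s))
stairs-++ c s (suc k) l = cong ((c , s) ∷_) (begin
  stairs c (suc s) (k + l)                        ≡⟨ stairs-++ c (suc s) k l ⟩
  stairs c (suc s) k ++ stairs c (suc (s + k)) l  ≡⟨ cong (λ t → stairs c (suc s) k ++ stairs c t l) (+-suc s k) ⟨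
  stairs c (suc s) k ++ stairs c (s + suc k) l    ∎)

applyUpTo-stairs : ∀ c s k (f : ℕ → ℕ) → (∀ i → f i ≡ s + i)
                   → applyUpTo (λ i → c , f i) k ≡ stairs c s k
applyUpTo-stairs c s zero f _ = refl
applyUpTo-stairs c s (suc k) f f≗ =
  cong₂ _∷_ (cong (c ,_) (trans (f≗ 0) (+-identityʳ s)))
            (applyUpTo-stairs c (suc s) k (f ∘ suc) (λ i → trans (f≗ (suc i)) (+-suc s i)))

render-stairs-zeroLed : ∀ {c s k Y} → 1 ≤ c → ZeroLed Y → ZeroLed (render (stairs c s k) Y)
render-stairs-zeroLed {k = zero} _ Y-led = Y-led
render-stairs-zeroLed {suc c} {k = suc k} _ _ = _ , refl

render-stairs-noLeadingOne : ∀ {c s k} → 1 ≤ c → NoLeadingOne (render (stairs c s k) [])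
render-stairs-noLeadingOne {k = zero} _ = ≮[]
render-stairs-noLeadingOne {k = suc k} 1≤c = zeros-noLeadingOne 1≤c

zeros-≮-stairs : ∀ {a c s k Z} → a < c → ¬ (rep a false ++ true ∷ Z) ≺ render (stairs c s k) []
zeros-≮-stairs {k = zero} _ = ≮[]
zeros-≮-stairs {k = suc k} a<c = zeros-≮ a<c

ones-≮-stairs : ∀ c j d {Z} → 1 ≤ c
                → ¬ (rep (d + j) true ++ Z) ≺ (rep j true ++ render (stairs c (suc j) d) [])
ones-≮-stairs c j zero _ = ≮[] ∘ ++-≺-++⁻ (rep j true)
ones-≮-stairs c j (suc d) 1≤c = ones-≮ (m<n+m j {suc d} (s≤s z≤n)) (zeros-noLeadingOne 1≤c)

block-≮-stairs : ∀ c j d {Z} → 1 ≤ c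
                 → ¬ (rep c false ++ rep (suc (d + j)) true ++ Z) ≺ render (stairs c (suc j) d) []
block-≮-stairs c j zero _ = ≮[]
block-≮-stairs c j (suc d) {Z} 1≤c p =
  ones-≮-stairs c (suc j) d 1≤c
    (subst (λ t → (rep t true ++ Z) ≺ (rep (suc j) true ++ render (stairs c (suc (suc j)) d) []))
           (sym (+-suc d j)) (∷-≺-∷⁻ (++-≺-++⁻ (rep c false) p)))

triangle : ℕ → ℕ
triangle zero = 0
triangle (suc k) = suc k + triangle k

triangle-double : ∀ k → k * (k + 1) ≡ triangle k * 2
triangle-double zero = refl
triangle-double (suc k) = begin
  suc k * (suc k + 1)               ≡⟨ step₁ k ⟩
  k * (k + 1) + suc k * 2           ≡⟨ cong (_+ suc k * 2) (triangle-double k) ⟩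
  triangle k * 2 + suc k * 2        ≡⟨ step₂ (triangle k) k ⟩
  (suc k + triangle k) * 2          ∎
  where
  step₁ : ∀ k → suc k * (suc k + 1) ≡ k * (k + 1) + suc k * 2
  step₁ = solve-∀
  step₂ : ∀ t k → t * 2 + suc k * 2 ≡ (suc k + t) * 2
  step₂ = solve-∀

triangle-half : ∀ k → (k * (k + 1)) / 2 ≡ triangle k
triangle-half k = trans (cong (_/ 2) (triangle-double k)) (m*n/n≡m (triangle k) 2)

permutation-attains-max : ∀ {m} (f : Fin (suc m) → ℕ) → Injective _≡_ _≡_ f
                          → (∀ i → 1 ≤ f i × f i ≤ suc m) → ∃[ i ] f i ≡ suc m
permutation-attains-max {m} f f-inj bounds with any? (λ i → f i ≟ suc m)
... | yes attained = attained
... | no unattained = contradiction (injective⇒≤ g-inj) (n≮n m)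
  where
  -- Otherwise pred ∘ f injects Fin (suc m) into Fin m.
  pred< : ∀ {a} → 1 ≤ a → a < suc m → pred a < m
  pred< (s≤s z≤n) (s<s a<m) = a<m
  pred-cancel : ∀ {a b} → 1 ≤ a → 1 ≤ b → pred a ≡ pred b → a ≡ b
  pred-cancel (s≤s z≤n) (s≤s z≤n) = cong suc
  below : ∀ i → pred (f i) < m
  below i = pred< (proj₁ (bounds i)) (≤∧≢⇒< (proj₂ (bounds i)) (unattained ∘ (i ,_)))
  g : Fin (suc m) → Fin m
  g i = fromℕ< (below i)
  g-inj : Injective _≡_ _≡_ g
  g-inj {x} {y} gx≡gy = f-inj (pred-cancel (proj₁ (bounds x)) (proj₁ (bounds y))
    (trans (sym (toℕ-fromℕ< (below x))) (trans (cong toℕ gx≡gy) (toℕ-fromℕ< (below y)))))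

∑-permutation : ∀ n (f : Fin n → ℕ) → Injective _≡_ _≡_ f → (∀ i → 1 ≤ f i × f i ≤ n)
                → ∑[ i < n ] f i ≡ triangle n
∑-permutation zero f _ _ = refl
∑-permutation (suc m) f f-inj bounds with permutation-attains-max f f-inj bounds
... | i , fi≡1+m = begin
  sum f
    ≡⟨ sum-remove {i = i} f ⟩
  f i + ∑[ k < m ] f (punchIn i k)
    ≡⟨ cong₂ _+_ fi≡1+m (∑-permutation m (f ∘ punchIn i) f∘punchIn-inj bounds′) ⟩
  suc m + triangle m ∎
  where
  f∘punchIn-inj : Injective _≡_ _≡_ (f ∘ punchIn i)
  f∘punchIn-inj = punchIn-injective i _ _ ∘ f-inj
  bounds′ : ∀ k → 1 ≤ f (punchIn i k) × f (punchIn i k) ≤ m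
  bounds′ k = proj₁ (bounds (punchIn i k)) ,
              ≤-pred (≤∧≢⇒< (proj₂ (bounds (punchIn i k)))
                            (λ e → punchInᵢ≢i i k (f-inj (trans e (sym fi≡1+m)))))

width : List Block → ℕ
width [] = 0
width ((a , s) ∷ bs) = a + suc s + width bs

width-tabulate : ∀ {n} (h : Fin n → Block) → width (tabulate h) ≡ ∑[ i < n ] (proj₁ (h i) + suc (proj₂ (h i)))
width-tabulate {zero} h = refl
width-tabulate {suc n} h =
  cong (proj₁ (h Fin.zero) + suc (proj₂ (h Fin.zero)) +_) (width-tabulate (h ∘ Fin.suc))

width-stairs : ∀ c s k → width (stairs c s k) ≡ k * (c + s) + triangle k
width-stairs c s zero = refl
width-stairs c s (suc k) = begin
  c + suc s + width (stairs c (suc s) k)          ≡⟨ cong (c + suc s +_) (width-stairs c (suc s) k) ⟩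
  c + suc s + (k * (c + suc s) + triangle k)      ≡⟨ rearrange c s k (triangle k) ⟩
  suc k * (c + s) + (suc k + triangle k)          ∎
  where
  rearrange : ∀ c s k t → c + suc s + (k * (c + suc s) + t) ≡ suc k * (c + s) + (suc k + t)
  rearrange = solve-∀

drop-rep : ∀ a (x : Bool) Y → drop a (rep a x ++ Y) ≡ Y
drop-rep zero x Y = refl
drop-rep (suc a) x Y = drop-rep a x Y

drop-rep-+ : ∀ a k (x : Bool) Y → drop (a + k) (rep a x ++ Y) ≡ drop k Y
drop-rep-+ zero k x Y = refl
drop-rep-+ (suc a) k x Y = drop-rep-+ a k x Y

rep-+ : ∀ a b (x : Bool) Y → rep (a + b) x ++ Y ≡ rep a x ++ rep b x ++ Y
rep-+ zero b x Y = refl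
rep-+ (suc a) b x Y = cong (x ∷_) (rep-+ a b x Y)

drop-rep-∸ : ∀ {v c} (x : Bool) Y → v ≤ c → drop (c ∸ v) (rep c x ++ Y) ≡ rep v x ++ Y
drop-rep-∸ {v} {c} x Y v≤c = begin
  drop (c ∸ v) (rep c x ++ Y)                   ≡⟨ cong (λ t → drop (c ∸ v) (rep t x ++ Y)) (m∸n+n≡m v≤c) ⟨
  drop (c ∸ v) (rep (c ∸ v + v) x ++ Y)         ≡⟨ cong (drop (c ∸ v)) (rep-+ (c ∸ v) v x Y) ⟩
  drop (c ∸ v) (rep (c ∸ v) x ++ rep v x ++ Y)  ≡⟨ drop-rep (c ∸ v) x _ ⟩
  rep v x ++ Y                                  ∎

drop-render : ∀ bs Y k → drop (width bs + k) (render bs Y) ≡ drop k Y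
drop-render [] Y k = refl
drop-render ((a , s) ∷ bs) Y k = begin
  drop (a + suc s + width bs + k) (rep a false ++ rep (suc s) true ++ render bs Y)
    ≡⟨ cong (λ t → drop t (render ((a , s) ∷ bs) Y)) (reassoc a (suc s) (width bs) k) ⟩
  drop (a + (suc s + (width bs + k))) (rep a false ++ rep (suc s) true ++ render bs Y)
    ≡⟨ drop-rep-+ a _ false _ ⟩
  drop (suc s + (width bs + k)) (rep (suc s) true ++ render bs Y)
    ≡⟨ drop-rep-+ (suc s) _ true _ ⟩
  drop (width bs + k) (render bs Y)
    ≡⟨ drop-render bs Y k ⟩
  drop k Y ∎
  where
  reassoc : ∀ a b c d → a + b + c + d ≡ a + (b + (c + d))
  reassoc = solve-∀

-- The text T

part₁ : ∀ n → (Fin n → ℕ) → List Block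
part₁ n A = map (λ i → A i , toℕ i) (allFin n)

-- The R of the header: the third part after its block 0^(n+1) 1^(j+1).
stairsAbove : ℕ → ℕ → List Bool
stairsAbove n j = render (stairs (suc n) (suc j) (n ∸ j)) []

textT-blocks : ∀ n A
               → textT n A ≡ render (part₁ n A) (render [ (suc n , n) ] (render (stairs (suc n) 0 (suc n)) []))
textT-blocks n A = begin
  textT n A
    ≡⟨ cong (λ Z → first ++ (rep c false ++ rep c true) ++ Z) part₃ ⟩
  first ++ (rep c false ++ rep c true) ++ render (stairs c 0 c) []
    ≡⟨ cong (first ++_) (++-assoc (rep c false) (rep c true) _) ⟩
  first ++ render [ (c , n) ] (render (stairs c 0 c) [])
    ≡⟨ concat-map-block (λ i → A i , toℕ i) (allFin n) _ ⟩
  render (part₁ n A) (render [ (c , n) ] (render (stairs c 0 c) [])) ∎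
  where
  c : ℕ
  c = suc n
  first : List Bool
  first = concat (map (block ∘ λ i → A i , toℕ i) (allFin n))
  part₃ : concat (map (λ i → rep c false ++ rep i true) (applyUpTo suc c)) ≡ render (stairs c 0 c) []
  part₃ = begin
    concat (map (λ i → rep c false ++ rep i true) (applyUpTo suc c))
      ≡⟨ cong concat (map-applyUpTo suc (λ i → rep c false ++ rep i true) c) ⟩
    concat (applyUpTo (block ∘ (c ,_)) c)
      ≡⟨ cong concat (map-upTo (block ∘ (c ,_)) c) ⟨
    concat (map (block ∘ (c ,_)) (upTo c))
      ≡⟨ ++-identityʳ _ ⟨
    concat (map (block ∘ (c ,_)) (upTo c)) ++ []
      ≡⟨ concat-map-block (c ,_) (upTo c) [] ⟩
    render (map (c ,_) (upTo c)) []
      ≡⟨ cong (λ bs → render bs []) (map-upTo (c ,_) c) ⟩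
    render (applyUpTo (c ,_) c) []
      ≡⟨ cong (λ bs → render bs []) (applyUpTo-stairs c 0 c (λ i → i) (λ _ → refl)) ⟩
    render (stairs c 0 c) [] ∎

text-split : ∀ n A {j} → j ≤ n
             → textT n A ≡ render (part₁ n A) (render [ (suc n , n) ]
                             (render (stairs (suc n) 0 j) (rep (suc n) false ++ rep (suc j) true ++ stairsAbove n j)))
text-split n A {j} j≤n = trans (textT-blocks n A)
  (cong (λ bs → render (part₁ n A) (render [ (suc n , n) ] bs)) (begin
    render (stairs (suc n) 0 (suc n)) []
      ≡⟨ cong (λ k → render (stairs (suc n) 0 k) []) 1+n≡j+1+d ⟩
    render (stairs (suc n) 0 (j + suc (n ∸ j))) []
      ≡⟨ cong (λ bs → render bs []) (stairs-++ (suc n) 0 j (suc (n ∸ j))) ⟩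
    render (stairs (suc n) 0 j ++ stairs (suc n) j (suc (n ∸ j))) []
      ≡⟨ render-++ (stairs (suc n) 0 j) _ [] ⟩
    render (stairs (suc n) 0 j) (render (stairs (suc n) j (suc (n ∸ j))) []) ∎))
  where
  1+n≡j+1+d : suc n ≡ j + suc (n ∸ j)
  1+n≡j+1+d = trans (cong suc (sym (m+[n∸m]≡n j≤n))) (sym (+-suc j (n ∸ j)))

module Text (n j v : ℕ) where

  open Band v (rep j true ++ stairsAbove n j) public

  stairsAbove-noLeadingOne : NoLeadingOne (stairsAbove n j)
  stairsAbove-noLeadingOne = render-stairs-noLeadingOne {suc n} {suc j} {n ∸ j} (s≤s z≤n)

  Part₁Block : Block → Set
  Part₁Block (a , _) = 1 ≤ a × a ≤ n

  -- Runs of the first part are shorter than the runs 0^(n+1) of R.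
  follower-part₁ : ∀ bs Y → All Part₁Block bs → ZeroLed Y → ¬ Y ≺ stairsAbove n j
                   → ZeroLed (render bs Y) × ¬ render bs Y ≺ stairsAbove n j
  follower-part₁ [] Y [] Y-led Y≮R = Y-led , Y≮R
  follower-part₁ ((suc a , s) ∷ bs) Y ((_ , 1+a≤n) ∷ _) _ _ =
    (_ , refl) , zeros-≮-stairs {s = suc j} {k = n ∸ j} (s≤s 1+a≤n)

  runCount-part₁ : ∀ bs Y → All Part₁Block bs → ZeroLed Y → ¬ Y ≺ stairsAbove n j
                   → runCount bs Y ≡ count (λ b → (proj₂ b <? j) ×-dec (v ≤? proj₁ b)) bs
  runCount-part₁ [] Y [] _ _ = refl
  runCount-part₁ ((a , s) ∷ bs) Y (_ ∷ bounds) Y-led Y≮R =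
    cong₂ _+_ first (runCount-part₁ bs Y bounds Y-led Y≮R)
    where
    follower : ZeroLed (render bs Y) × ¬ render bs Y ≺ stairsAbove n j
    follower = follower-part₁ bs Y bounds Y-led Y≮R
    first : 𝟙 ((rep s true ++ render bs Y) ≺? (rep j true ++ stairsAbove n j)) * 𝟙 (v ≤? a)
            ≡ 𝟙 ((s <? j) ×-dec (v ≤? a))
    first = trans (cong (_* 𝟙 (v ≤? a))
                        (𝟙-ones-≺ {s} {j} stairsAbove-noLeadingOne (λ _ → proj₁ follower) (λ _ → proj₂ follower)))
                  (sym (𝟙-× (s <? j) (v ≤? a)))

  runCount-part₁≡countA : ∀ A → (∀ i → 1 ≤ A i × A i ≤ n) → ∀ Y → ZeroLed Y → ¬ Y ≺ stairsAbove n j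
                          → runCount (part₁ n A) Y ≡ countA A j v
  runCount-part₁≡countA A bounds Y Y-led Y≮R = begin
    runCount (part₁ n A) Y
      ≡⟨ runCount-part₁ (part₁ n A) Y (map⁺ (tabulate⁺ bounds)) Y-led Y≮R ⟩
    count (λ b → (proj₂ b <? j) ×-dec (v ≤? proj₁ b)) (part₁ n A)
      ≡⟨ count-map _ (λ i → A i , toℕ i) (allFin n) ⟩
    count (λ i → (toℕ i <? j) ×-dec (v ≤? A i)) (allFin n)
      ≡⟨ sym (count-filter (λ i → toℕ i <? j) (λ i → v ≤? A i) (allFin n)) ⟩
    count (λ i → v ≤? A i) (filter (λ i → toℕ i <? j) (allFin n))
      ≡⟨ sym (length-filter≡count (λ i → v ≤? A i) (filter (λ i → toℕ i <? j) (allFin n))) ⟩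
    countA A j v ∎

  middle-≮ : j ≤ n → ∀ Z → ¬ (rep (suc n) false ++ rep (suc n) true ++ Z) ≺ stairsAbove n j
  middle-≮ j≤n Z = subst (λ t → ¬ (rep (suc n) false ++ rep (suc t) true ++ Z) ≺ stairsAbove n j)
                         (m∸n+n≡m j≤n) (block-≮-stairs (suc n) j (n ∸ j) (s≤s z≤n))

  runCount-middle : j ≤ n → ∀ Y → runCount [ (suc n , n) ] Y ≡ 0
  runCount-middle j≤n Y = cong (λ k → k * 𝟙 (v ≤? suc n) + 0) (𝟙-no (_ ≺? _) ones≮)
    where
    ones≮ : ¬ (rep n true ++ Y) ≺ (rep j true ++ stairsAbove n j)
    ones≮ = subst (λ t → ¬ (rep t true ++ Y) ≺ (rep j true ++ stairsAbove n j))
                  (m∸n+n≡m j≤n) (ones-≮-stairs (suc n) j (n ∸ j) (s≤s z≤n))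

  runCount-stairs-below : v ≤ suc n → ∀ s k Y → s + k ≤ j → ZeroLed Y → runCount (stairs (suc n) s k) Y ≡ k
  runCount-stairs-below v≤1+n s zero Y _ _ = refl
  runCount-stairs-below v≤1+n s (suc k) Y s+k≤j Y-led =
    cong₂ _+_ first (runCount-stairs-below v≤1+n (suc s) k Y 1+s+k≤j Y-led)
    where
    1+s+k≤j : suc s + k ≤ j
    1+s+k≤j = subst (_≤ j) (+-suc s k) s+k≤j
    first : 𝟙 ((rep s true ++ render (stairs (suc n) (suc s) k) Y) ≺? (rep j true ++ stairsAbove n j))
            * 𝟙 (v ≤? suc n) ≡ 1
    first = cong₂ _*_ (𝟙-yes (_ ≺? _) (ones-≺ (≤-trans (s≤s (m≤m+n s k)) 1+s+k≤j)
                                              (render-stairs-zeroLed {suc n} {suc s} {k} (s≤s z≤n) Y-led)))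
                      (𝟙-yes (v ≤? suc n) v≤1+n)

  runCount-stairs-above : ∀ s k Y → j < s → runCount (stairs (suc n) s k) Y ≡ 0
  runCount-stairs-above s zero Y _ = refl
  runCount-stairs-above s (suc k) Y j<s =
    cong₂ _+_ (cong (_* 𝟙 (v ≤? suc n)) (𝟙-no (_ ≺? _) (ones-≮ j<s stairsAbove-noLeadingOne)))
              (runCount-stairs-above (suc s) k Y (m<n⇒m<1+n j<s))

  bandCount-part₃ : 1 ≤ v → v ≤ suc n
                    → bandCount (render (stairs (suc n) 0 j) (rep (suc n) false ++ rep (suc j) true ++ stairsAbove n j))
                      ≡ j
  bandCount-part₃ 1≤v v≤1+n = begin
    bandCount (render (stairs (suc n) 0 j) S)
      ≡⟨ bandCount-render 1≤v (stairs (suc n) 0 j) S ⟩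
    runCount (stairs (suc n) 0 j) S + bandCount S
      ≡⟨ cong₂ _+_ (runCount-stairs-below v≤1+n 0 j S ≤-refl (_ , refl))
                   (bandCount-render 1≤v [ (suc n , j) ] (stairsAbove n j)) ⟩
    j + (runCount [ (suc n , j) ] (stairsAbove n j) + bandCount (stairsAbove n j))
      ≡⟨ cong (λ k → j + (k * 𝟙 (v ≤? suc n) + 0 + bandCount (stairsAbove n j)))
              (𝟙-no ((rep j true ++ stairsAbove n j) ≺? (rep j true ++ stairsAbove n j)) ≺-irrefl) ⟩
    j + bandCount (stairsAbove n j)
      ≡⟨ cong (j +_) (bandCount-render 1≤v (stairs (suc n) (suc j) (n ∸ j)) []) ⟩
    j + (runCount (stairs (suc n) (suc j) (n ∸ j)) [] + 0)
      ≡⟨ cong (λ k → j + (k + 0)) (runCount-stairs-above (suc j) (n ∸ j) [] ≤-refl) ⟩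
    j + 0
      ≡⟨ +-identityʳ j ⟩
    j ∎
    where
    S : List Bool
    S = rep (suc n) false ++ rep (suc j) true ++ stairsAbove n j

  bandCount-text : 1 ≤ v → v ≤ suc n → j ≤ n → ∀ A → (∀ i → 1 ≤ A i × A i ≤ n)
                   → bandCount (textT n A) ≡ countA A j v + j
  bandCount-text 1≤v v≤1+n j≤n A bounds = begin
    bandCount (textT n A)
      ≡⟨ cong bandCount (text-split n A j≤n) ⟩
    bandCount (render (part₁ n A) M)
      ≡⟨ bandCount-render 1≤v (part₁ n A) M ⟩
    runCount (part₁ n A) M + bandCount M
      ≡⟨ cong₂ _+_ (runCount-part₁≡countA A bounds M (_ , refl) (middle-≮ j≤n P₃))
                   (bandCount-render 1≤v [ (suc n , n) ] P₃) ⟩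
    countA A j v + (runCount [ (suc n , n) ] P₃ + bandCount P₃)
      ≡⟨ cong (λ k → countA A j v + (k + bandCount P₃)) (runCount-middle j≤n P₃) ⟩
    countA A j v + bandCount P₃
      ≡⟨ cong (countA A j v +_) (bandCount-part₃ 1≤v v≤1+n) ⟩
    countA A j v + j ∎
    where
    P₃ M : List Bool
    P₃ = render (stairs (suc n) 0 j) (rep (suc n) false ++ rep (suc j) true ++ stairsAbove n j)
    M = render [ (suc n , n) ] P₃

width-part₁ : ∀ n A → Injective _≡_ _≡_ A → (∀ i → 1 ≤ A i × A i ≤ n) → width (part₁ n A) ≡ triangle n + triangle n
width-part₁ n A A-inj bounds = begin
  width (part₁ n A)                                  ≡⟨ cong width (map-tabulate (λ i → i) (λ i → A i , toℕ i)) ⟩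
  width (tabulate (λ i → A i , toℕ i))               ≡⟨ width-tabulate (λ i → A i , toℕ i) ⟩
  ∑[ i < n ] (A i + suc (toℕ i))                     ≡⟨ ∑-distrib-+ A (suc ∘ toℕ) ⟩
  ∑[ i < n ] A i + ∑[ i < n ] suc (toℕ i)            ≡⟨ cong₂ _+_ (∑-permutation n A A-inj bounds)
                                                                 (∑-permutation n (suc ∘ toℕ) 1+toℕ-inj 1+toℕ-bounds) ⟩
  triangle n + triangle n                            ∎
  where
  1+toℕ-inj : Injective _≡_ _≡_ (suc ∘ toℕ {n})
  1+toℕ-inj = toℕ-injective ∘ suc-injective
  1+toℕ-bounds : ∀ i → 1 ≤ suc (toℕ i) × suc (toℕ i) ≤ n
  1+toℕ-bounds i = s≤s z≤n , toℕ<n i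

position : ∀ n j v → v ≤ suc n
           → n * (n + 1) + 2 * (n + 1) + (j * (n + 1) + (j * (j + 1)) / 2 + (n + 2 ∸ v)) ∸ 1
             ≡ (triangle n + triangle n) + ((suc n + suc n + 0) + ((j * (suc n + 0) + triangle j) + (suc n ∸ v)))
position n j v v≤1+n
  rewrite triangle-double n | triangle-half j | trans (cong (_∸ v) (+-comm n 2)) (+-∸-assoc 1 v≤1+n)
  = cong (_∸ 1) (rearrange (triangle n) (triangle j) n j (suc n ∸ v))
  where
  rearrange : ∀ tn tj n j x → tn * 2 + 2 * (n + 1) + (j * (n + 1) + tj + suc x)
                              ≡ suc ((tn + tn) + ((suc n + suc n + 0) + ((j * (suc n + 0) + tj) + x)))
  rearrange = solve-∀

suffix-text : ∀ n j v A → Injective _≡_ _≡_ A → (∀ i → 1 ≤ A i × A i ≤ n) → j ≤ n → v ≤ suc n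
              → suffix (textT n A) (n * (n + 1) + 2 * (n + 1) + (j * (n + 1) + (j * (j + 1)) / 2 + (n + 2 ∸ v)))
                ≡ rep v false ++ rep (suc j) true ++ stairsAbove n j
suffix-text n j v A A-inj bounds j≤n v≤1+n = begin
  drop (p ∸ 1) (textT n A)
    ≡⟨ cong₂ drop (trans (position n j v v≤1+n) (sym widths)) (text-split n A j≤n) ⟩
  drop (width (part₁ n A) + (width [ (suc n , n) ] + (width (stairs (suc n) 0 j) + (suc n ∸ v))))
       (render (part₁ n A) (render [ (suc n , n) ] (render (stairs (suc n) 0 j) S)))
    ≡⟨ drop-render (part₁ n A) _ _ ⟩
  drop (width [ (suc n , n) ] + (width (stairs (suc n) 0 j) + (suc n ∸ v)))
       (render [ (suc n , n) ] (render (stairs (suc n) 0 j) S))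
    ≡⟨ drop-render [ (suc n , n) ] _ _ ⟩
  drop (width (stairs (suc n) 0 j) + (suc n ∸ v)) (render (stairs (suc n) 0 j) S)
    ≡⟨ drop-render (stairs (suc n) 0 j) S _ ⟩
  drop (suc n ∸ v) S
    ≡⟨ drop-rep-∸ false _ v≤1+n ⟩
  rep v false ++ rep (suc j) true ++ stairsAbove n j ∎
  where
  p : ℕ
  p = n * (n + 1) + 2 * (n + 1) + (j * (n + 1) + (j * (j + 1)) / 2 + (n + 2 ∸ v))
  S : List Bool
  S = rep (suc n) false ++ rep (suc j) true ++ stairsAbove n j
  widths : width (part₁ n A) + (width [ (suc n , n) ] + (width (stairs (suc n) 0 j) + (suc n ∸ v)))
           ≡ (triangle n + triangle n) + ((suc n + suc n + 0) + ((j * (suc n + 0) + triangle j) + (suc n ∸ v)))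
  widths = cong₂ _+_ (width-part₁ n A A-inj bounds)
                     (cong (λ w → suc n + suc n + 0 + (w + (suc n ∸ v))) (width-stairs (suc n) 0 j))

lemmaA1 : (n : ℕ) → (A : Fin n → ℕ) → 1 ≤ n
          → Injective _≡_ _≡_ A → (∀ i → 1 ≤ A i × A i ≤ n)
          → (j v : ℕ) → j ≤ n → 1 ≤ v → v ≤ n
          → countA A j v + (countSmaller (textT n A) (rep v false ++ [ true ]) + j + 1)
            ≡ ISA (textT n A) (n * (n + 1) + 2 * (n + 1) + (j * (n + 1) + (j * (j + 1)) / 2 + (n + 2 ∸ v)))
-- 1 ≤ n is implied by 1 ≤ v ≤ n.
lemmaA1 n A _ A-inj bounds j v j≤n 1≤v v≤n = begin
  countA A j v + (countSmaller T w + j + 1)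
    ≡⟨ rearrange (countA A j v) (countSmaller T w) j ⟩
  suc (countSmaller T w + (countA A j v + j))
    ≡⟨ cong (λ k → suc (countSmaller T w + k)) (sym (bandCount-text 1≤v v≤1+n j≤n A bounds)) ⟩
  suc (countSmaller T w + bandCount T)
    ≡⟨ cong suc (sym (countSmaller-band T)) ⟩
  suc (countSmaller T (rep v false ++ rep (suc j) true ++ stairsAbove n j))
    ≡⟨ cong (suc ∘ countSmaller T) (sym (suffix-text n j v A A-inj bounds j≤n v≤1+n)) ⟩
  ISA T (n * (n + 1) + 2 * (n + 1) + (j * (n + 1) + (j * (j + 1)) / 2 + (n + 2 ∸ v))) ∎
  where
  open Text n j v
  T w : List Bool
  T = textT n A
  w = rep v false ++ [ true ]
  v≤1+n : v ≤ suc n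
  v≤1+n = m≤n⇒m≤1+n v≤n
  rearrange : ∀ a b j → a + (b + j + 1) ≡ suc (b + (a + j))
  rearrange = solve-∀
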